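{- Let $\ell,k,\ell_{\max}$ be positive integers. There is an $(\ell,k)$-routing instance on the full-duplex infinite triangular grid in which every packet's origin and destination are at distance $\ell_{\max}$, such that every schedule routing each packet along a shortest path from its origin to its destination needs at least $\min\{\ell,k\}\cdot\ell_{\max}$ steps. In particular, the worst-case running time of any algorithm for $(\ell,k)$-routing on full-duplex triangular grids using shortest path routing is at least $\min\{\ell,k\}\cdot\ell_{\max}$, where $\ell_{\max}$ is the maximum origin–destination distance of the instance.
   Context: Triangular grid: the infinite graph with vertex set $\mathbb{Z}^2$ in which $(x,y)$ is adjacent to $(x\pm1,y)$, $(x,y\pm1)$, $(x+1,y+1)$ and $(x-1,y-1)$. $(\ell,k)$-routing: a set of packets, each with an origin and a destination node, such that each node is the origin of at most $\ell$ packets and the destination of at most $k$ packets. Routing model (store-and-forward, $\Delta$-port): synchronous steps; in each step each packet either stays at its current node (unbounded queues) or moves along one incident edge; all incident edges of a node may be used simultaneously; full-duplex: each edge can be traversed by at most one packet per step in each direction. Running time: number of steps until all packets reach their destinations. -}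

module Defs where

open import Data.Nat using (ℕ; zero; suc; _+_; _≤_)
open import Data.Integer using (ℤ) renaming (_+_ to _+ℤ_; _-_ to _-ℤ_)
import Data.Integer as ℤ
open import Data.Fin using (Fin)
import Data.Fin as Fin
open import Data.Sum using (_⊎_)
open import Data.Product using (_×_; _,_; proj₁; proj₂; Σ)
open import Data.Product.Properties using (≡-dec)
open import Relation.Binary.PropositionalEquality using (_≡_; _≢_)
open import Relation.Nullary using (¬_; Dec; yes; no; ¬?)

Node : Set
Node = ℤ × ℤ

_≟N_ : (u v : Node) → Dec (u ≡ v)
_≟N_ = ≡-dec ℤ._≟_ ℤ._≟_

one : ℤ
one = ℤ.+ 1

data Adj : Node → Node → Set where
  right : ∀ x y → Adj (x , y) (x +ℤ one , y)
  left  : ∀ x y → Adj (x , y) (x -ℤ one , y)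
  up    : ∀ x y → Adj (x , y) (x , y +ℤ one)
  down  : ∀ x y → Adj (x , y) (x , y -ℤ one)
  diag+ : ∀ x y → Adj (x , y) (x +ℤ one , y +ℤ one)
  diag- : ∀ x y → Adj (x , y) (x -ℤ one , y -ℤ one)

data Walk : Node → Node → ℕ → Set where
  nil  : ∀ u → Walk u u 0
  cons : ∀ {u v w n} → Adj u v → Walk v w n → Walk u w (suc n)

IsDist : Node → Node → ℕ → Set
IsDist u v d = Walk u v d × (∀ m → Walk u v m → d ≤ m)

count : ∀ {n} {P : Fin n → Set} → (∀ i → Dec (P i)) → ℕ
count {zero}  d = 0
count {suc n} d with d Fin.zero
... | yes _ = suc (count (λ i → d (Fin.suc i)))
... | no  _ = count (λ i → d (Fin.suc i))

countBelow : (T : ℕ) {P : ℕ → Set} → (∀ t → Dec (P t)) → ℕ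
countBelow zero    d = 0
countBelow (suc T) d with d T
... | yes _ = suc (countBelow T d)
... | no  _ = countBelow T d

Instance : Set
Instance = Σ ℕ (λ n → Fin n → Node × Node)

origin : (I : Instance) → Fin (proj₁ I) → Node
origin (n , P) i = proj₁ (P i)

dest : (I : Instance) → Fin (proj₁ I) → Node
dest (n , P) i = proj₂ (P i)

IsLKRouting : ℕ → ℕ → Instance → Set
IsLKRouting ℓ k I =
  ∀ v → count (λ i → origin I i ≟N v) ≤ ℓ × count (λ i → dest I i ≟N v) ≤ k

Schedule : Instance → Set
Schedule I = Fin (proj₁ I) → ℕ → Node

-- Validity in the full-duplex store-and-forward Δ-port model:
-- start at origin; at each step stay or move along one incident edge;
-- no two distinct packets traverse the same directed edge in the same step.
ValidSchedule : (I : Instance) → Schedule I → Set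
ValidSchedule I pos =
  (∀ i → pos i 0 ≡ origin I i)
  × (∀ i t → pos i (suc t) ≡ pos i t ⊎ Adj (pos i t) (pos i (suc t)))
  × (∀ i j t → i ≢ j → ¬ (pos i t ≡ pos j t × pos i (suc t) ≡ pos j (suc t) × pos i t ≢ pos i (suc t)))

moves : (I : Instance) → Schedule I → Fin (proj₁ I) → ℕ → ℕ
moves I pos i T = countBelow T (λ t → ¬? (pos i t ≟N pos i (suc t)))

-- The schedule delivers all packets by time T, each routed along a shortest
-- path: it is at its destination at time T and the walk it traced up to T
-- has length equal to the origin–destination distance.
ShortestPathCompletesBy : (I : Instance) → Schedule I → ℕ → Set
ShortestPathCompletesBy I pos T =
  ∀ i → pos i T ≡ dest I i × IsDist (origin I i) (dest I i) (moves I pos i T)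

module Submission where

-- With m = min ℓ k and L = ℓmax, the witness has m·L packets on the x-axis:
-- packet i goes from (r , 0) to (r + L , 0) with r = i mod L, so each node is
-- the origin and the destination of at most m packets (counting lemmas).
-- The potential ψ(x , y) = 2x − y rises by at most 2 along a grid edge, and by
-- exactly 2 only along a step to the right.  Since ψ rises by 2L from origin
-- to destination, these are at distance L (walk lemmas), and a packet that
-- arrives after L moves has moved only rightwards (trajectory lemmas).  By a
-- discrete intermediate value theorem it then crosses the directed edge
-- (L − 1 , 0) → (L , 0); full duplex lets at most one packet cross that edge
-- per step (edge congestion), hence m·L ≤ T.

open import Defs
open import Data.Nat using (ℕ; zero; suc; _+_; _*_; _⊓_; _≤_; _<_; z≤n; s≤s; NonZero)
import Data.Nat.Properties as ℕP
open import Data.Nat.DivMod using (_%_; m<n⇒m%n≡m; [m+n]%n≡m%n; m%n<n)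
open import Data.Nat.Tactic.RingSolver using (solve-∀)
open import Data.Integer as ℤ using (ℤ; +_; +≤+; +<+) renaming (_+_ to _+ℤ_)
import Data.Integer.Properties as ℤP
import Data.Integer.Tactic.RingSolver as ℤSolver
open import Algebra.Properties.AbelianGroup ℤP.+-0-abelianGroup using (∙-cancelˡ)
open import Data.Fin as Fin using (Fin; toℕ; fromℕ<)
import Data.Fin.Properties as FinP
open import Data.Product using (Σ; _×_; _,_; proj₁; proj₂)
open import Data.Sum using (_⊎_; inj₁; inj₂)
open import Data.Empty using (⊥-elim)
open import Relation.Nullary using (¬_; Dec; yes; no; ¬?)
open import Relation.Binary.PropositionalEquality

countℕ : (n : ℕ) {G : ℕ → Set} → (∀ j → Dec (G j)) → ℕ
countℕ zero    g = 0
countℕ (suc n) g with g 0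
... | yes _ = suc (countℕ n (λ j → g (suc j)))
... | no  _ = countℕ n (λ j → g (suc j))

count-toℕ : ∀ n {G : ℕ → Set} (g : ∀ j → Dec (G j)) →
  count {n} (λ i → g (toℕ i)) ≡ countℕ n g
count-toℕ zero    g = refl
count-toℕ (suc n) g with g 0
... | yes _ = cong suc (count-toℕ n (λ j → g (suc j)))
... | no  _ = count-toℕ n (λ j → g (suc j))

countℕ-+ : ∀ a n {G : ℕ → Set} (g : ∀ j → Dec (G j)) →
  countℕ (a + n) g ≡ countℕ a g + countℕ n (λ j → g (a + j))
countℕ-+ zero    n g = refl
countℕ-+ (suc a) n g with g 0
... | yes _ = cong suc (countℕ-+ a n (λ j → g (suc j)))
... | no  _ = countℕ-+ a n (λ j → g (suc j))

countℕ-mono : ∀ n {G H : ℕ → Set} (g : ∀ j → Dec (G j)) (h : ∀ j → Dec (H j)) →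
  (∀ j → G j → H j) → countℕ n g ≤ countℕ n h
countℕ-mono zero    g h G⇒H = z≤n
countℕ-mono (suc n) g h G⇒H with g 0 | h 0
... | yes _  | yes _  = s≤s (countℕ-mono n _ _ (λ j → G⇒H (suc j)))
... | yes g0 | no ¬h0 = ⊥-elim (¬h0 (G⇒H 0 g0))
... | no _   | yes _  = ℕP.m≤n⇒m≤1+n (countℕ-mono n _ _ (λ j → G⇒H (suc j)))
... | no _   | no _   = countℕ-mono n _ _ (λ j → G⇒H (suc j))

countℕ-none : ∀ n {G : ℕ → Set} (g : ∀ j → Dec (G j)) →
  (∀ j → j < n → ¬ G j) → countℕ n g ≡ 0
countℕ-none zero    g none = refl
countℕ-none (suc n) g none with g 0
... | yes g0 = ⊥-elim (none 0 (s≤s z≤n) g0)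
... | no  _  = countℕ-none n _ (λ j j<n → none (suc j) (s≤s j<n))

countℕ-unique : ∀ n {G : ℕ → Set} (g : ∀ j → Dec (G j)) →
  (∀ a b → a < n → b < n → G a → G b → a ≡ b) → countℕ n g ≤ 1
countℕ-unique zero    g unique = z≤n
countℕ-unique (suc n) g unique with g 0
... | yes g0 = s≤s (ℕP.≤-reflexive (countℕ-none n _ (λ j j<n gj →
                 ℕP.0≢1+n (unique 0 (suc j) (s≤s z≤n) (s≤s j<n) g0 gj))))
... | no  _  = countℕ-unique n _ (λ a b a<n b<n ga gb →
                 ℕP.suc-injective (unique (suc a) (suc b) (s≤s a<n) (s≤s b<n) ga gb))

-- If at most one residue satisfies Q, then among the first m·L naturals at
-- most m have their residue mod L in Q: at most one per block of length L.
countℕ-periodic : ∀ m L .{{_ : NonZero L}} {Q : ℕ → Set} (q : ∀ r → Dec (Q r)) →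
  (∀ a b → Q a → Q b → a ≡ b) → countℕ (m * L) (λ j → q (j % L)) ≤ m
countℕ-periodic zero    L q unique = z≤n
countℕ-periodic (suc m) L {Q} q unique
  rewrite countℕ-+ L (m * L) (λ j → q (j % L)) =
  ℕP.+-mono-≤ firstBlock (ℕP.≤-trans shifted (countℕ-periodic m L q unique))
  where
  firstBlock : countℕ L (λ j → q (j % L)) ≤ 1
  firstBlock = countℕ-unique L _ (λ a b a<L b<L qa qb →
    trans (sym (m<n⇒m%n≡m a<L)) (trans (unique _ _ qa qb) (m<n⇒m%n≡m b<L)))
  shifted : countℕ (m * L) (λ j → q ((L + j) % L)) ≤ countℕ (m * L) (λ j → q (j % L))
  shifted = countℕ-mono (m * L) _ _ (λ j → subst Q
    (trans (cong (_% L) (ℕP.+-comm L j)) ([m+n]%n≡m%n j L)))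

count-periodic : ∀ m L .{{_ : NonZero L}} {Q : ℕ → Set} (q : ∀ r → Dec (Q r)) →
  (∀ a b → Q a → Q b → a ≡ b) → count {m * L} (λ i → q (toℕ i % L)) ≤ m
count-periodic m L q unique =
  subst (_≤ m) (sym (count-toℕ (m * L) (λ j → q (j % L)))) (countℕ-periodic m L q unique)

ψ : Node → ℤ
ψ (x , y) = (x +ℤ x) ℤ.- y

-- Gain a b g s: passing from potential a to potential b gains g − s,
-- where s ≥ 0 is the slack by which the gain falls short of g.
record Gain (a b : ℤ) (g s : ℕ) : Set where
  constructor gain
  field balance : b +ℤ + s ≡ a +ℤ + g

gain-trans : ∀ {a b c g h s t} → Gain a b g s → Gain b c h t → Gain a c (g + h) (s + t)
gain-trans {a} {b} {c} {g} {h} {s} {t} (gain ab) (gain bc) = gain (begin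
  c +ℤ + (s + t)       ≡⟨ cong (c +ℤ_) (ℤP.pos-+ s t) ⟩
  c +ℤ (+ s +ℤ + t)    ≡⟨ swap c (+ s) (+ t) ⟩
  (c +ℤ + t) +ℤ + s    ≡⟨ cong (_+ℤ + s) bc ⟩
  (b +ℤ + h) +ℤ + s    ≡⟨ swap′ b (+ h) (+ s) ⟩
  (b +ℤ + s) +ℤ + h    ≡⟨ cong (_+ℤ + h) ab ⟩
  (a +ℤ + g) +ℤ + h    ≡⟨ ℤP.+-assoc a (+ g) (+ h) ⟩
  a +ℤ (+ g +ℤ + h)    ≡⟨ cong (a +ℤ_) (ℤP.pos-+ g h) ⟨
  a +ℤ + (g + h)       ∎)
  where
  open ≡-Reasoning
  swap : ∀ x y z → x +ℤ (y +ℤ z) ≡ (x +ℤ z) +ℤ y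
  swap = ℤSolver.solve-∀
  swap′ : ∀ x y z → (x +ℤ y) +ℤ z ≡ (x +ℤ z) +ℤ y
  swap′ = ℤSolver.solve-∀

gain-exact : ∀ {a d g s} → Gain a (a +ℤ + d) g s → d + s ≡ g
gain-exact {a} {d} {g} {s} (gain e) = ℤP.+-injective (∙-cancelˡ a (+ (d + s)) (+ g) (begin
  a +ℤ + (d + s)       ≡⟨ cong (a +ℤ_) (ℤP.pos-+ d s) ⟩
  a +ℤ (+ d +ℤ + s)    ≡⟨ ℤP.+-assoc a (+ d) (+ s) ⟨
  (a +ℤ + d) +ℤ + s    ≡⟨ e ⟩
  a +ℤ + g             ∎))
  where open ≡-Reasoning

RightStep : Node → Node → Set
RightStep u v = v ≡ (proj₁ u +ℤ one , proj₂ u)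

-- The slack of a grid step: 2 minus the increase of ψ along it.
slack : ∀ {u v} → Adj u v → ℕ
slack (right x y) = 0
slack (left  x y) = 4
slack (up    x y) = 3
slack (down  x y) = 1
slack (diag+ x y) = 1
slack (diag- x y) = 3

adj-gain : ∀ {u v} (e : Adj u v) → Gain (ψ u) (ψ v) 2 (slack e)
adj-gain (right x y) = gain (gain-right x y)
  where
  gain-right : ∀ x y → ((x +ℤ + 1) +ℤ (x +ℤ + 1)) ℤ.- y +ℤ + 0 ≡ (x +ℤ x) ℤ.- y +ℤ + 2
  gain-right = ℤSolver.solve-∀
adj-gain (left x y) = gain (gain-left x y)
  where
  gain-left : ∀ x y → ((x ℤ.- + 1) +ℤ (x ℤ.- + 1)) ℤ.- y +ℤ + 4 ≡ (x +ℤ x) ℤ.- y +ℤ + 2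
  gain-left = ℤSolver.solve-∀
adj-gain (up x y) = gain (gain-up x y)
  where
  gain-up : ∀ x y → (x +ℤ x) ℤ.- (y +ℤ + 1) +ℤ + 3 ≡ (x +ℤ x) ℤ.- y +ℤ + 2
  gain-up = ℤSolver.solve-∀
adj-gain (down x y) = gain (gain-down x y)
  where
  gain-down : ∀ x y → (x +ℤ x) ℤ.- (y ℤ.- + 1) +ℤ + 1 ≡ (x +ℤ x) ℤ.- y +ℤ + 2
  gain-down = ℤSolver.solve-∀
adj-gain (diag+ x y) = gain (gain-diag+ x y)
  where
  gain-diag+ : ∀ x y → ((x +ℤ + 1) +ℤ (x +ℤ + 1)) ℤ.- (y +ℤ + 1) +ℤ + 1 ≡ (x +ℤ x) ℤ.- y +ℤ + 2
  gain-diag+ = ℤSolver.solve-∀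
adj-gain (diag- x y) = gain (gain-diag- x y)
  where
  gain-diag- : ∀ x y → ((x ℤ.- + 1) +ℤ (x ℤ.- + 1)) ℤ.- (y ℤ.- + 1) +ℤ + 3 ≡ (x +ℤ x) ℤ.- y +ℤ + 2
  gain-diag- = ℤSolver.solve-∀

slack-zero⇒right : ∀ {u v} (e : Adj u v) → slack e ≡ 0 → RightStep u v
slack-zero⇒right (right x y) _ = refl

walk-gain : ∀ {u w m} → Walk u w m → Σ ℕ (Gain (ψ u) (ψ w) (2 * m))
walk-gain (nil u) = 0 , gain refl
walk-gain {u} {w} (cons {n = n} e rest) with walk-gain rest
... | S , restGain =
  slack e + S , subst (λ g → Gain (ψ u) (ψ w) g (slack e + S)) (sym (ℕP.*-suc 2 n))
                  (gain-trans (adj-gain e) restGain)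

axis : ℕ → Node
axis a = (+ a , + 0)

axis-injective : ∀ {a b} → axis a ≡ axis b → a ≡ b
axis-injective e = ℤP.+-injective (cong proj₁ e)

ψ-axis : ∀ r L → ψ (axis (r + L)) ≡ ψ (axis r) +ℤ + (2 * L)
ψ-axis r L = cong +_ (shift r L)
  where
  shift : ∀ r L → (r + L) + (r + L) + 0 ≡ (r + r + 0) + 2 * L
  shift = solve-∀

walk-right : ∀ r L → Walk (axis r) (axis (r + L)) L
walk-right r zero    = subst (λ a → Walk (axis r) (axis a) 0) (sym (ℕP.+-identityʳ r)) (nil _)
walk-right r (suc L) = cons (right (+ r) (+ 0))
  (subst (λ a → Walk (axis (r + 1)) (axis a) L) (ℕP.+-assoc r 1 L) (walk-right (r + 1) L))

-- (r , 0) and (r + L , 0) are at distance exactly L: a walk of length m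
-- raises ψ by at most 2m, and ψ must rise by 2L.
axis-distance : ∀ r L → IsDist (axis r) (axis (r + L)) L
axis-distance r L = walk-right r L , lower
  where
  lower : ∀ m → Walk (axis r) (axis (r + L)) m → L ≤ m
  lower m w with walk-gain w
  ... | S , walkGain =
    ℕP.*-cancelˡ-≤ 2 (subst (2 * L ≤_) (gain-exact exact) (ℕP.m≤m+n (2 * L) S))
    where
    exact : Gain (ψ (axis r)) (ψ (axis r) +ℤ + (2 * L)) (2 * m) S
    exact = subst (λ b → Gain (ψ (axis r)) b (2 * m) S) (ψ-axis r L) walkGain

squeeze : ∀ {a c : ℤ} → a ℤ.≤ c → c ℤ.< a +ℤ one → a ≡ c
squeeze {a} {c} a≤c c<a+1 with a ℤ.≟ c
... | yes a≡c = a≡c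
... | no  a≢c = ⊥-elim (ℤP.<-irrefl (ℤP.+-comm one a)
                  (ℤP.≤-<-trans (ℤP.i<j⇒suc[i]≤j (ℤP.≤∧≢⇒< a≤c a≢c)) c<a+1))

step-across : (a : ℕ → ℤ) (c : ℤ) (T : ℕ) →
  (∀ t → t < T → a (suc t) ≡ a t ⊎ a (suc t) ≡ a t +ℤ one) →
  a 0 ℤ.≤ c → c ℤ.< a T →
  Σ ℕ λ t → t < T × a t ≡ c × a (suc t) ≡ c +ℤ one
step-across a c zero    steps a0≤c c<a0 = ⊥-elim (ℤP.<-irrefl refl (ℤP.≤-<-trans a0≤c c<a0))
step-across a c (suc T) steps a0≤c c<aT+1 with c ℤP.<? a T
... | yes c<aT =
  let (t , t<T , at≡c , at+1≡c+1) = step-across a c T (λ t t<T → steps t (ℕP.m<n⇒m<1+n t<T)) a0≤c c<aT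
  in t , ℕP.m<n⇒m<1+n t<T , at≡c , at+1≡c+1
... | no c≮aT with steps T (ℕP.n<1+n T)
...   | inj₁ stay = ⊥-elim (c≮aT (subst (c ℤ.<_) stay c<aT+1))
...   | inj₂ rise = T , ℕP.n<1+n T , aT≡c , trans rise (cong (_+ℤ one) aT≡c)
  where
  aT≡c : a T ≡ c
  aT≡c = squeeze (ℤP.≮⇒≥ c≮aT) (subst (c ℤ.<_) rise c<aT+1)

module Trajectory (p : ℕ → Node) (step : ∀ t → p (suc t) ≡ p t ⊎ Adj (p t) (p (suc t))) where

  -- The number of moves made during the first t steps; this is `moves` of the schedule.
  moved : ℕ → ℕ
  moved t = countBelow t (λ s → ¬? (p s ≟N p (suc s)))

  moved-suc : ∀ t → (p t ≢ p (suc t) × moved (suc t) ≡ suc (moved t))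
                  ⊎ (p t ≡ p (suc t) × moved (suc t) ≡ moved t)
  moved-suc t with p t ≟N p (suc t)
  ... | yes same = inj₂ (same , refl)
  ... | no  move = inj₁ (move , refl)

  Rightward : ℕ → Set
  Rightward s = p (suc s) ≡ p s ⊎ RightStep (p s) (p (suc s))

  RightwardBefore : ℕ → Set
  RightwardBefore t = ∀ s → s < t → Rightward s

  rightward-extend : ∀ {t} → RightwardBefore t → Rightward t → RightwardBefore (suc t)
  rightward-extend before now s s<1+t with ℕP.m<1+n⇒m<n∨m≡n s<1+t
  ... | inj₁ s<t  = before s s<t
  ... | inj₂ refl = now

  trajectory-gain : ∀ t → Σ ℕ λ S → Gain (ψ (p 0)) (ψ (p t)) (2 * moved t) S
                                      × (S ≡ 0 → RightwardBefore t)
  trajectory-gain zero = 0 , gain refl , λ _ s ()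
  trajectory-gain (suc t) with trajectory-gain t | moved-suc t
  ... | S , G , exact | inj₂ (same , count) =
    S , subst₂ (λ b m → Gain (ψ (p 0)) (ψ b) (2 * m) S) same (sym count) G ,
    λ S≡0 → rightward-extend (exact S≡0) (inj₁ (sym same))
  ... | S , G , exact | inj₁ (move , count) with step t
  ...   | inj₁ stay = ⊥-elim (move (sym stay))
  ...   | inj₂ e    =
    S + slack e , subst (λ m → Gain (ψ (p 0)) (ψ (p (suc t))) m (S + slack e)) twice
                        (gain-trans G (adj-gain e)) ,
    λ zero-slack → rightward-extend (exact (ℕP.m+n≡0⇒m≡0 S zero-slack))
                                    (inj₂ (slack-zero⇒right e (ℕP.m+n≡0⇒n≡0 S zero-slack)))
    where
    twice : 2 * moved t + 2 ≡ 2 * moved (suc t)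
    twice = trans (ℕP.+-comm (2 * moved t) 2)
                  (trans (sym (ℕP.*-suc 2 (moved t))) (cong (2 *_) (sym count)))

  shortest⇒rightward : ∀ T r L → p 0 ≡ axis r → p T ≡ axis (r + L) → moved T ≤ L →
                       RightwardBefore T
  shortest⇒rightward T r L start end few with trajectory-gain T
  ... | S , G , exact = exact (ℕP.n≤0⇒n≡0 (ℕP.+-cancelˡ-≤ (2 * L) S 0 bound))
    where
    G′ : Gain (ψ (axis r)) (ψ (axis r) +ℤ + (2 * L)) (2 * moved T) S
    G′ = subst₂ (λ a b → Gain (ψ a) b (2 * moved T) S) start (trans (cong ψ end) (ψ-axis r L)) G
    bound : 2 * L + S ≤ 2 * L + 0
    bound = subst₂ _≤_ (sym (gain-exact G′)) (sym (ℕP.+-identityʳ (2 * L)))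
                   (ℕP.*-monoʳ-≤ 2 few)

  rightward-crosses : ∀ T r L c → RightwardBefore T → p 0 ≡ axis r → p T ≡ axis (r + L) →
                      r ≤ c → c < r + L →
                      Σ ℕ λ t → t < T × p t ≡ axis c × p (suc t) ≡ axis (suc c)
  rightward-crosses T r L c rightward start end r≤c c<r+L =
    onAxis (step-across (λ t → proj₁ (p t)) (+ c) T x-steps
             (subst (ℤ._≤ + c) (sym (cong proj₁ start)) (+≤+ r≤c))
             (subst (+ c ℤ.<_) (sym (cong proj₁ end)) (+<+ c<r+L)))
    where
    x-steps : ∀ s → s < T → proj₁ (p (suc s)) ≡ proj₁ (p s) ⊎ proj₁ (p (suc s)) ≡ proj₁ (p s) +ℤ one
    x-steps s s<T with rightward s s<T
    ... | inj₁ stay = inj₁ (cong proj₁ stay)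
    ... | inj₂ rt   = inj₂ (cong proj₁ rt)
    on-axis : ∀ s → s ≤ T → proj₂ (p s) ≡ + 0
    on-axis zero    _     = cong proj₂ start
    on-axis (suc s) s<T with rightward s s<T
    ... | inj₁ stay = trans (cong proj₂ stay) (on-axis s (ℕP.<⇒≤ s<T))
    ... | inj₂ rt   = trans (cong proj₂ rt) (on-axis s (ℕP.<⇒≤ s<T))
    onAxis : (Σ ℕ λ t → t < T × proj₁ (p t) ≡ + c × proj₁ (p (suc t)) ≡ + c +ℤ one) →
             Σ ℕ λ t → t < T × p t ≡ axis c × p (suc t) ≡ axis (suc c)
    onAxis (t , t<T , xt , xt+1) =
      t , t<T , cong₂ _,_ xt (on-axis t (ℕP.<⇒≤ t<T)) ,
      cong₂ _,_ (trans xt+1 (cong +_ (ℕP.+-comm c 1))) (on-axis (suc t) t<T)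

-- In a valid schedule at most one packet traverses a given directed edge
-- u → v in each step; so if every packet traverses it before time T, the
-- traversal times are distinct and there are at most T packets.
edge-congestion : (I : Instance) (pos : Schedule I) → ValidSchedule I pos →
  ∀ {u v} T → u ≢ v → (∀ i → Σ ℕ λ t → t < T × pos i t ≡ u × pos i (suc t) ≡ v) →
  proj₁ I ≤ T
edge-congestion I pos (_ , _ , exclusive) {u} {v} T u≢v traverses =
  FinP.injective⇒≤ {f = time} time-injective
  where
  time : Fin (proj₁ I) → Fin T
  time i = fromℕ< (proj₁ (proj₂ (traverses i)))
  time-injective : ∀ {i j} → time i ≡ time j → i ≡ j
  time-injective {i} {j} same with traverses i | traverses j | i Fin.≟ j
  ... | _ | _ | yes i≡j = i≡j
  ... | t , t<T , iu , iv | t′ , t′<T , ju , jv | no i≢j =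
    ⊥-elim (exclusive i j t i≢j (trans iu (sym ju′) , trans iv (sym jv′) , λ eq → u≢v (trans (sym iu) (trans eq iv))))
    where
    t≡t′ : t ≡ t′
    t≡t′ = FinP.fromℕ<-injective t t′ t<T t′<T same
    ju′ : pos j t ≡ u
    ju′ = subst (λ s → pos j s ≡ u) (sym t≡t′) ju
    jv′ : pos j (suc t) ≡ v
    jv′ = subst (λ s → pos j (suc s) ≡ v) (sym t≡t′) jv

module AxisInstance (m L′ : ℕ) where

  L : ℕ
  L = suc L′

  start : Fin (m * L) → ℕ
  start i = toℕ i % L

  axisInstance : Instance
  axisInstance = m * L , λ i → axis (start i) , axis (start i + L)

  -- Each node is the origin of at most m packets and the destination of at
  -- most m packets: one per block of L consecutive packet indices.
  routing : ∀ {ℓ k} → m ≤ ℓ → m ≤ k → IsLKRouting ℓ k axisInstance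
  routing m≤ℓ m≤k v =
    ℕP.≤-trans (count-periodic m L (λ a → axis a ≟N v)
                  (λ a b a↦v b↦v → axis-injective (trans a↦v (sym b↦v)))) m≤ℓ ,
    ℕP.≤-trans (count-periodic m L (λ a → axis (a + L) ≟N v)
                  (λ a b a↦v b↦v → ℕP.+-cancelʳ-≡ L a b (axis-injective (trans a↦v (sym b↦v))))) m≤k

  distances : ∀ i → IsDist (origin axisInstance i) (dest axisInstance i) L
  distances i = axis-distance (start i) L

  -- Every packet routed along a shortest path crosses (L′ , 0) → (L , 0),
  -- and only one packet can do so per step.
  congestion : ∀ (pos : Schedule axisInstance) T → ValidSchedule axisInstance pos →
               ShortestPathCompletesBy axisInstance pos T → m * L ≤ T
  congestion pos T valid@(starts , steps , _) completes =
    edge-congestion axisInstance pos valid T axis-step-distinct crosses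
    where
    axis-step-distinct : axis L′ ≢ axis L
    axis-step-distinct eq = ℕP.1+n≢n (sym (axis-injective eq))
    crosses : ∀ i → Σ ℕ λ t → t < T × pos i t ≡ axis L′ × pos i (suc t) ≡ axis L
    crosses i = rightward-crosses T (start i) L L′ rightward (starts i) arrives
                  (ℕP.≤-pred (m%n<n (toℕ i) L)) (ℕP.m≤n+m L (start i))
      where
      open Trajectory (pos i) (steps i)
      arrives : pos i T ≡ axis (start i + L)
      arrives = proj₁ (completes i)
      rightward : RightwardBefore T
      rightward = shortest⇒rightward T (start i) L (starts i) arrives
                    (proj₂ (proj₂ (completes i)) L (walk-right (start i) L))

mainTheorem8 : (ℓ k ℓmax : ℕ) → 1 ≤ ℓ → 1 ≤ k → 1 ≤ ℓmax →
    Σ Instance (λ I →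
      IsLKRouting ℓ k I
      × (∀ i → IsDist (origin I i) (dest I i) ℓmax)
      × (∀ (pos : Schedule I) (T : ℕ) →
           ValidSchedule I pos → ShortestPathCompletesBy I pos T →
           (ℓ ⊓ k) * ℓmax ≤ T))
mainTheorem8 ℓ k zero     _ _ ()
mainTheorem8 ℓ k (suc L′) _ _ _ =
  axisInstance , routing (ℕP.m⊓n≤m ℓ k) (ℕP.m⊓n≤n ℓ k) , distances , congestion
  where open AxisInstance (ℓ ⊓ k) L′
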